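{- Let $k\in\mathbb{N}$ and let $H_0\in\{\mathbb{P},\ \mathbb{N}\setminus\mathbb{P}\}$. Then every syndetic set $A\subset\mathbb{N}$ contains a $2$-term geometric progression with common ratio $n^k r$ for some $n\in H_0\setminus\{1\}$ and some $r\in\mathbb{N}$ with $r\equiv 1\pmod{n}$; that is, there exist $x\in\mathbb{N}$, $n\in H_0\setminus\{1\}$ and $r\in\mathbb{N}$ with $r\equiv 1 \pmod n$ such that $\{x,\ x n^k r\}\subset A$.
   Context: $\mathbb{N}=\{1,2,3,\dots\}$ and $\mathbb{P}$ is the set of primes. For $l\in\mathbb{N}$, a set $A\subset\mathbb{N}$ is $l$-syndetic if $A$ has nonempty intersection with every set of $l$ consecutive natural numbers; $A$ is syndetic if it is $l$-syndetic for some $l\in\mathbb{N}$. -}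

module Defs where

open import Data.Nat using (ℕ; _+_; _≤_; _<_)
open import Data.Nat.Primality using (Prime)
open import Data.Bool using (Bool; true; false)
open import Data.Product using (∃-syntax; _×_)
open import Relation.Nullary using (¬_)

-- Subsets of ℕ = {1,2,3,...} are represented as predicates on Agda's ℕ;
-- membership of 0 is irrelevant, since every quantifier below requires ≥ 1.

LSyndetic : ℕ → (ℕ → Set) → Set
LSyndetic l A = ∀ m → 1 ≤ m → ∃[ a ] (m ≤ a × a < m + l × A a)

Syndetic : (ℕ → Set) → Set
Syndetic A = ∃[ l ] (1 ≤ l × LSyndetic l A)

H₀ : Bool → ℕ → Set
H₀ true  n = Prime n
H₀ false n = 1 ≤ n × ¬ Prime n

module Submission where

-- Fix an l-syndetic set A.  We maintain a "base" B, a modulus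
-- M ≥ 1 and, for some of the l slots B+1, ..., B+l of the window after B,
-- a *mark*: a factorisation  B + 1 + j = x · nᵏ · (1 + n s)  with x ∈ A,
-- n ∈ H₀, n > 1, and x·nᵏ·n ∣ M.  Syndeticity gives an element of A in
-- the window.  If it lies in a marked slot, the mark is exactly the
-- required pair {x, x·nᵏ·r} with r = 1 + n s.  Otherwise it lies in a free
-- slot, at x = B + 1 + j; a number-theoretic "multiplier" n ∈ H₀, n > 1,
-- T with M ∣ T and 1 + T = nᵏ (1 + n s) lets us move the base to B + x T:
-- the slot j becomes marked since B + x T + 1 + j = x (1 + T), and every
-- old mark survives because x·nᵏ·n ∣ M ∣ x T.  The number of free slots
-- drops, so after at most l steps the element of A hits a marked slot
-- (the argument works for every k, including k = 0).

open import Data.Nat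
open import Data.Nat.Properties
open import Data.Nat.Divisibility
open import Data.Nat.Primality
open import Data.Nat.Primality.Factorisation using (factorise)
open import Data.Nat.Coprimality using (Coprime; coprime-divisor; coprime-Bézout)
open import Data.Nat.GCD using (module Bézout)
open import Data.Nat.ListAction using (product)
open import Data.Nat.Induction using (<-wellFounded)
open import Data.Nat.Tactic.RingSolver using (solve-∀)
open import Data.List using ([]; _∷_)
open import Data.List.Relation.Unary.All using (_∷_)
open import Data.Fin using (Fin; toℕ; fromℕ<)
open import Data.Fin.Properties using (toℕ-fromℕ<) renaming (_≟_ to _≟ᶠ_)
open import Data.Fin.Subset using (Subset; ⊤; _∉_; _-_; ∣_∣)
open import Data.Fin.Subset.Properties using (_∈?_; ∈⊤; x∈p∧x≢y⇒x∈p-y; x∈p⇒∣p-x∣<∣p∣)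
open import Data.Bool using (Bool; true; false)
open import Data.Product using (∃-syntax; _×_; _,_)
open import Data.Sum using (inj₁; inj₂)
open import Data.Empty using (⊥-elim)
open import Induction.WellFounded using (Acc; acc)
open import Relation.Nullary using (¬_; yes; no)
open import Relation.Binary.PropositionalEquality
open import Defs

pow-one-mod : ∀ M w k → ∃[ q ] (1 + M * w) ^ k ≡ 1 + M * q
pow-one-mod M w zero    = 0 , cong suc (sym (*-zeroʳ M))
pow-one-mod M w (suc k) with pow-one-mod M w k
... | q , eq = w + q + M * w * q , trans (cong ((1 + M * w) *_) eq) (product-one-mod M w q)
  where
  product-one-mod : ∀ M w q → (1 + M * w) * (1 + M * q) ≡ 1 + M * (w + q + M * w * q)
  product-one-mod = solve-∀

-- Every positive M has a prime not dividing it: any prime factor of M + 1.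
prime-not-dividing : ∀ M → 1 ≤ M → ∃[ p ] (Prime p × ¬ p ∣ M)
prime-not-dividing M M≥1 with factorise (suc M)
... | record { factors = [] ; isFactorisation = M+1≡1 } =
  ⊥-elim (<⇒≢ (s≤s M≥1) (sym M+1≡1))
... | record { factors = p ∷ ps ; isFactorisation = M+1≡Π ; factorsPrime = p-prime ∷ _ } =
  p , p-prime , λ p∣M → ¬prime[1] (subst Prime (∣1⇒≡1 (∣m+n∣m⇒∣n p∣M+1 p∣M)) p-prime)
  where
  p∣M+1 : p ∣ M + 1
  p∣M+1 = subst (p ∣_) (trans (sym M+1≡Π) (+-comm 1 M)) (m∣m*n (product ps))

prime∤⇒coprime : ∀ {p m} → Prime p → ¬ p ∣ m → Coprime m p
prime∤⇒coprime p-prime p∤m (d∣m , d∣p) with prime⇒irreducible p-prime d∣p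
... | inj₁ d≡1 = d≡1
... | inj₂ refl = ⊥-elim (p∤m d∣m)

coprime-* : ∀ {m n o} → Coprime m n → Coprime m o → Coprime m (n * o)
coprime-* {n = n} m⊥n m⊥o {d} (d∣m , d∣no) = m⊥o (d∣m , coprime-divisor d⊥n d∣no)
  where
  d⊥n : Coprime d n
  d⊥n (e∣d , e∣n) = m⊥n (∣-trans e∣d d∣m , e∣n)

coprime-^ : ∀ {m n} → Coprime m n → ∀ j → Coprime m (n ^ j)
coprime-^ m⊥n zero    (_ , d∣1) = ∣1⇒≡1 d∣1
coprime-^ m⊥n (suc j) = coprime-* m⊥n (coprime-^ m⊥n j)

-- A unit modulo N ≥ 2 has an inverse: x * M ≡ 1 (mod N).  Bézout gives
-- x M ≡ ±1 (mod N); in the case x M ≡ -1 the inverse is (N - 1) x.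
modular-inverse : ∀ M N → 2 ≤ N → Coprime M N → ∃[ x ] ∃[ y ] x * M ≡ 1 + y * N
modular-inverse M 1 (s≤s ()) _
modular-inverse M (suc (suc m)) _ M⊥N with coprime-Bézout M⊥N
... | Bézout.+- x y 1+yN≡xM = x , y , sym 1+yN≡xM
... | Bézout.-+ x zero 1+xM≡0 =
  ⊥-elim (1+n≢0 (trans 1+xM≡0 (*-zeroˡ (suc (suc m)))))
... | Bézout.-+ x (suc y) 1+xM≡[1+y]N =
  suc m * x , m + suc m * y , (begin
    suc m * x * M                   ≡⟨ *-assoc (suc m) x M ⟩
    suc m * (x * M)                 ≡⟨ cong (suc m *_) (suc-injective 1+xM≡[1+y]N) ⟩
    suc m * (suc m + y * (2 + m))   ≡⟨ negate-inverse m y ⟩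
    1 + (m + suc m * y) * (2 + m)   ∎)
  where
  open ≡-Reasoning
  negate-inverse : ∀ m y → suc m * (suc m + y * (2 + m)) ≡ 1 + (m + suc m * y) * (2 + m)
  negate-inverse = solve-∀

record Multiplier (h : Bool) (k M : ℕ) : Set where
  field
    ratio    : ℕ
    shift    : ℕ
    cofactor : ℕ
    ratio∈H₀ : H₀ h ratio
    ratio>1  : 1 < ratio
    M∣shift  : M ∣ shift
    shape    : 1 + shift ≡ ratio ^ k * (1 + ratio * cofactor)

-- The key identity of the prime case, written with pᵏ = 1 + e:
-- if x M = 1 + y p pᵏ then 1 + M x e = pᵏ (1 + p y e).
inverse-shape : ∀ M x y p e → x * M ≡ 1 + y * (p * suc e) →
                1 + M * (x * e) ≡ suc e * (1 + p * (y * e))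
inverse-shape M x y p e xM≡1+y[p*pᵏ] = begin
  1 + M * (x * e)                ≡⟨ cong suc (reorder M x e) ⟩
  1 + x * M * e                  ≡⟨ cong (λ z → 1 + z * e) xM≡1+y[p*pᵏ] ⟩
  1 + (1 + y * (p * suc e)) * e  ≡⟨ expand y p e ⟩
  suc e * (1 + p * (y * e))      ∎
  where
  open ≡-Reasoning
  reorder : ∀ M x e → M * (x * e) ≡ x * M * e
  reorder = solve-∀
  expand : ∀ y p e → 1 + (1 + y * (p * suc e)) * e ≡ suc e * (1 + p * (y * e))
  expand = solve-∀

prime>1 : ∀ {p} → Prime p → 1 < p
prime>1 {p} p-prime = nonTrivial⇒n>1 p {{prime⇒nonTrivial p-prime}}

-- H₀ = ℙ: take a prime p ∤ M and x with x M ≡ 1 (mod pᵏ⁺¹); then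
-- T = x M (pᵏ - 1) ≡ pᵏ - 1 (mod pᵏ⁺¹), i.e. 1 + T ≡ pᵏ (mod pᵏ⁺¹).
prime-multiplier : ∀ k M p → Prime p → ¬ p ∣ M → Multiplier true k M
prime-multiplier k M p p-prime p∤M
  with x , y , xM≡1+y[p*pᵏ] ← modular-inverse M (p ^ suc k)
         (*-mono-≤ (prime>1 p-prime) (m^n>0 p {{prime⇒nonZero p-prime}} k))
         (coprime-^ (prime∤⇒coprime p-prime p∤M) (suc k)) = record
  { ratio    = p
  ; shift    = M * (x * e)
  ; cofactor = y * e
  ; ratio∈H₀ = p-prime
  ; ratio>1  = prime>1 p-prime
  ; M∣shift  = m∣m*n (x * e)
  ; shape    = subst (λ P → 1 + M * (x * e) ≡ P * (1 + p * (y * e))) 1+e≡pᵏ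
      (inverse-shape M x y p e (subst (λ P → x * M ≡ 1 + y * (p * P)) (sym 1+e≡pᵏ) xM≡1+y[p*pᵏ]))
  }
  where
  instance _ = prime⇒nonZero p-prime
  e : ℕ
  e = pred (p ^ k)
  1+e≡pᵏ : suc e ≡ p ^ k
  1+e≡pᵏ = suc-pred (p ^ k) {{m^n≢0 p k}}

-- H₀ = ℕ ∖ ℙ: n = (M + 1)² is composite and n ≡ 1 (mod M), so T = nᵏ - 1
-- works with cofactor 0.
square-multiplier : ∀ k M → 1 ≤ M → Multiplier false k M
square-multiplier k (suc m) _ with q , nᵏ≡1+Mq ← pow-one-mod (suc m) (3 + m) k = record
  { ratio    = n
  ; shift    = suc m * q
  ; cofactor = 0
  ; ratio∈H₀ = <⇒≤ n>1 , composite⇒¬prime (composite d<n (m∣m*n d))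
  ; ratio>1  = n>1
  ; M∣shift  = m∣m*n q
  ; shape    = begin
      1 + suc m * q                ≡⟨ nᵏ≡1+Mq ⟨
      (1 + suc m * (3 + m)) ^ k    ≡⟨ cong (_^ k) (square-one-mod m) ⟨
      n ^ k                        ≡⟨ *-identityʳ (n ^ k) ⟨
      n ^ k * 1                    ≡⟨ cong (λ z → n ^ k * (1 + z)) (*-zeroʳ n) ⟨
      n ^ k * (1 + n * 0)          ∎
  }
  where
  open ≡-Reasoning
  d n : ℕ
  d = 2 + m
  n = d * d
  d<n : d < n
  d<n = m<m*n d d (s≤s (s≤s z≤n))
  n>1 : 1 < n
  n>1 = ≤-trans (s≤s (s≤s z≤n)) (<⇒≤ d<n)
  square-one-mod : ∀ m → (2 + m) * (2 + m) ≡ 1 + suc m * (3 + m)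
  square-one-mod = solve-∀

multiplier : ∀ h k M → 1 ≤ M → Multiplier h k M
multiplier true  k M M≥1 with p , p-prime , p∤M ← prime-not-dividing M M≥1 =
  prime-multiplier k M p p-prime p∤M
multiplier false k M M≥1 = square-multiplier k M M≥1

window-slot : ∀ {l A} → LSyndetic l A → ∀ B → ∃[ j ] A (B + suc (toℕ {l} j))
window-slot {l} {A} syn B with a , B<a , a<B+1+l , a∈A ← syn (suc B) (s≤s z≤n) =
  fromℕ< offset<l , subst A (sym slot≡a) a∈A
  where
  offset<l : a ∸ suc B < l
  offset<l = subst (a ∸ suc B <_) (m+n∸m≡n (suc B) l) (∸-monoˡ-< a<B+1+l B<a)
  slot≡a : B + suc (toℕ (fromℕ< offset<l)) ≡ a
  slot≡a = begin
    B + suc (toℕ (fromℕ< offset<l))  ≡⟨ cong (λ t → B + suc t) (toℕ-fromℕ< offset<l) ⟩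
    B + suc (a ∸ suc B)              ≡⟨ +-suc B (a ∸ suc B) ⟩
    suc B + (a ∸ suc B)              ≡⟨ m+[n∸m]≡n B<a ⟩
    a                                ∎
    where open ≡-Reasoning

module Marking (k : ℕ) (h : Bool) (A : ℕ → Set) where

  GeometricPair : Set
  GeometricPair = ∃[ x ] ∃[ n ] ∃[ r ]
    (1 ≤ x × H₀ h n × ¬ (n ≡ 1) × 1 ≤ r × n ∣ (r ∸ 1) × A x × A (x * n ^ k * r))

  record Mark (B M j : ℕ) : Set where
    constructor mark
    field
      base     : ℕ
      ratio    : ℕ
      cofactor : ℕ
      base∈A   : A base
      base≥1   : 1 ≤ base
      ratio∈H₀ : H₀ h ratio
      ratio>1  : 1 < ratio
      position : B + suc j ≡ base * ratio ^ k * (1 + ratio * cofactor)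
      period∣M : base * ratio ^ k * ratio ∣ M

  mark⇒pair : ∀ {B M j} → Mark B M j → A (B + suc j) → GeometricPair
  mark⇒pair m slot∈A =
    base , ratio , 1 + ratio * cofactor , base≥1 , ratio∈H₀ , ≢-sym (<⇒≢ ratio>1) ,
    s≤s z≤n , m∣m*n cofactor , base∈A , subst A position slot∈A
    where open Mark m

  -- Moving the base by a multiple U of M keeps a mark: U is a multiple of
  -- the period x nᵏ n, which only changes the cofactor s.
  shift-mark : ∀ {B M j U} → Mark B M j → M ∣ U → Mark (B + U) M j
  shift-mark {B} {M} {j} {U} m M∣U with divides q U≡q*period ← ∣-trans (Mark.period∣M m) M∣U =
    mark base ratio (cofactor + q) base∈A base≥1 ratio∈H₀ ratio>1 shifted period∣M
    where
    open Mark m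
    open ≡-Reasoning
    absorb : ∀ X n s q → X * (1 + n * s) + q * (X * n) ≡ X * (1 + n * (s + q))
    absorb = solve-∀
    shifted : B + U + suc j ≡ base * ratio ^ k * (1 + ratio * (cofactor + q))
    shifted = begin
      B + U + suc j                      ≡⟨ +-assoc B U (suc j) ⟩
      B + (U + suc j)                    ≡⟨ cong (B +_) (+-comm U (suc j)) ⟩
      B + (suc j + U)                    ≡⟨ +-assoc B (suc j) U ⟨
      B + suc j + U                      ≡⟨ cong₂ _+_ position U≡q*period ⟩
      base * ratio ^ k * (1 + ratio * cofactor) + q * (base * ratio ^ k * ratio)
                                         ≡⟨ absorb (base * ratio ^ k) ratio cofactor q ⟩
      base * ratio ^ k * (1 + ratio * (cofactor + q)) ∎

  widen-mark : ∀ {B M M' j} → Mark B M j → M ∣ M' → Mark B M' j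
  widen-mark (mark x n s x∈A x≥1 n∈H₀ n>1 position period∣M) M∣M' =
    mark x n s x∈A x≥1 n∈H₀ n>1 position (∣-trans period∣M M∣M')

  next-base : ∀ {M} → (B j : ℕ) → Multiplier h k M → ℕ
  next-base B j μ = B + (B + suc j) * Multiplier.shift μ

  next-modulus : ∀ {M} → (B j : ℕ) → Multiplier h k M → ℕ
  next-modulus {M} B j μ = M * ((B + suc j) * ratio ^ k * ratio)
    where open Multiplier μ

  slot≥1 : ∀ B j → 1 ≤ B + suc j
  slot≥1 B j = ≤-trans (s≤s z≤n) (m≤n+m (suc j) B)

  next-modulus≥1 : ∀ {M} B j (μ : Multiplier h k M) → 1 ≤ M → 1 ≤ next-modulus B j μ
  next-modulus≥1 B j μ M≥1 =
    *-mono-≤ M≥1 (*-mono-≤ (*-mono-≤ (slot≥1 B j) (m^n>0 ratio {{>-nonZero ratio>0}} k)) ratio>0)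
    where
    open Multiplier μ
    ratio>0 : 0 < ratio
    ratio>0 = <⇒≤ ratio>1

  new-mark : ∀ {B M j} (μ : Multiplier h k M) → A (B + suc j) →
             Mark (next-base B j μ) (next-modulus B j μ) j
  new-mark {B} {M} {j} μ x∈A =
    mark x ratio cofactor x∈A (slot≥1 B j) ratio∈H₀ ratio>1 filled (n∣m*n M)
    where
    open Multiplier μ
    open ≡-Reasoning
    x : ℕ
    x = B + suc j
    collect : ∀ B j T → B + (B + suc j) * T + suc j ≡ (B + suc j) * (1 + T)
    collect = solve-∀
    filled : next-base B j μ + suc j ≡ x * ratio ^ k * (1 + ratio * cofactor)
    filled = begin
      B + x * shift + suc j                 ≡⟨ collect B j shift ⟩
      x * (1 + shift)                       ≡⟨ cong (x *_) shape ⟩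
      x * (ratio ^ k * (1 + ratio * cofactor)) ≡⟨ *-assoc x (ratio ^ k) _ ⟨
      x * ratio ^ k * (1 + ratio * cofactor)   ∎

  Marked : ∀ {l} → (B M : ℕ) → Subset l → Set
  Marked B M F = ∀ j → j ∉ F → Mark B M (toℕ j)

  -- Filling a free slot j: the old marks survive (the base moves by
  -- x T with M ∣ T, and the modulus by a factor) and slot j gets a new one.
  fill-slot : ∀ {l B M} {F : Subset l} (j : Fin l) (μ : Multiplier h k M) →
              A (B + suc (toℕ j)) → Marked B M F →
              Marked (next-base B (toℕ j) μ) (next-modulus B (toℕ j) μ) (F - j)
  fill-slot {B = B} {M} j μ x∈A marked c c∉F-j with c ≟ᶠ j
  ... | yes refl = new-mark μ x∈A
  ... | no  c≢j  = widen-mark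
    (shift-mark (marked c c∉F) (∣n⇒∣m*n (B + suc (toℕ j)) (Multiplier.M∣shift μ)))
    (m∣m*n _)
    where
    c∉F : c ∉ _
    c∉F c∈F = c∉F-j (x∈p∧x≢y⇒x∈p-y c∈F c≢j)

  search : ∀ {l} → LSyndetic l A → (F : Subset l) → Acc _<_ ∣ F ∣ →
           ∀ B M → 1 ≤ M → Marked B M F → GeometricPair
  search syn F (acc smaller) B M M≥1 marked
    with j , slot∈A ← window-slot syn B
    with j ∈? F
  ... | no  j∉F = mark⇒pair (marked j j∉F) slot∈A
  ... | yes j∈F = search syn (F - j) (smaller (x∈p⇒∣p-x∣<∣p∣ j∈F))
                    (next-base B (toℕ j) μ) (next-modulus B (toℕ j) μ)
                    (next-modulus≥1 B (toℕ j) μ M≥1) (fill-slot j μ slot∈A marked)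
    where
    μ : Multiplier h k M
    μ = multiplier h k M M≥1

theorem1p8 : (k : ℕ) → 1 ≤ k → (h : Bool) → (A : ℕ → Set) → Syndetic A →
    ∃[ x ] ∃[ n ] ∃[ r ]
      (1 ≤ x × H₀ h n × ¬ (n ≡ 1) × 1 ≤ r × n ∣ (r ∸ 1) ×
       A x × A (x * n ^ k * r))
theorem1p8 k _ h A (l , _ , syn) =
  search syn ⊤ (<-wellFounded _) 0 1 (s≤s z≤n) (λ j j∉⊤ → ⊥-elim (j∉⊤ ∈⊤))
  where open Marking k h A
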